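{- Let $x$ be a formula. (a) If $x$ is a $\mathrm{T}$-term, then $\mathrm{se}(x)$ is closed by $\mathsf{T}$. (b) If $x$ is an $\mathrm{F}$-term, then $\mathrm{se}(x)$ is closed by $\mathsf{F}$. (c) If $x$ is an $\ell$-term or a $\mathrm{T}*$-term, then $\mathrm{se}(x)$ is open.
   Context: Fix a set $\mathcal{A}$ of atoms. Formulas: $x ::= \mathrm{T} \mid a \mid \neg x \mid x \mathbin{\triangleleft\wedge} x$ ($a\in\mathcal{A}$), with abbreviations $\mathrm{F}:=\neg\mathrm{T}$ and $x\mathbin{\triangleleft\vee}y:=\neg(\neg x\mathbin{\triangleleft\wedge}\neg y)$. Trees: $X ::= \mathsf{T}\mid\mathsf{F}\mid X\trianglelefteq a\trianglerighteq X$; substitution $X[\mathsf{T}\mapsto Y,\mathsf{F}\mapsto Z]$ replaces $\mathsf{T}$-leaves by $Y$ and $\mathsf{F}$-leaves by $Z$. $\mathrm{se}(\mathrm{T})=\mathsf{T}$, $\mathrm{se}(a)=\mathsf{T}\trianglelefteq a\trianglerighteq\mathsf{F}$, $\mathrm{se}(\neg x)=\mathrm{se}(x)[\mathsf{T}\mapsto\mathsf{F},\mathsf{F}\mapsto\mathsf{T}]$, $\mathrm{se}(x\mathbin{\triangleleft\wedge}y)=\mathrm{se}(x)[\mathsf{T}\mapsto\mathrm{se}(y),\mathsf{F}\mapsto\mathsf{F}]$. A tree is closed by $\mathsf{T}$ (resp. $\mathsf{F}$) if all its leaves are $\mathsf{T}$ (resp. $\mathsf{F}$), and open if it is not closed.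 Consider the grammar (with $a\in\mathcal{A}$): $P ::= P^{\mathrm{T}}\mid P^{\mathrm{F}}\mid P^{\mathrm{T}}\mathbin{\triangleleft\wedge}P^*$; $P^{\mathrm{T}} ::= \mathrm{T}\mid (a\mathbin{\triangleleft\wedge}P^{\mathrm{T}})\mathbin{\triangleleft\vee}P^{\mathrm{T}}$; $P^{\mathrm{F}} ::= \mathrm{F}\mid (a\mathbin{\triangleleft\vee}P^{\mathrm{F}})\mathbin{\triangleleft\wedge}P^{\mathrm{F}}$; $P^* ::= P^c\mid P^d$; $P^\ell ::= (a\mathbin{\triangleleft\wedge}P^{\mathrm{T}})\mathbin{\triangleleft\vee}P^{\mathrm{F}}\mid(\neg a\mathbin{\triangleleft\wedge}P^{\mathrm{T}})\mathbin{\triangleleft\vee}P^{\mathrm{F}}$; $P^c ::= P^\ell\mid P^*\mathbin{\triangleleft\wedge}P^d$; $P^d ::= P^\ell\mid P^*\mathbin{\triangleleft\vee}P^c$. Formulas generated by $P^{\mathrm{T}}$ are $\mathrm{T}$-terms, by $P^{\mathrm{F}}$ are $\mathrm{F}$-terms, by $P^\ell$ are $\ell$-terms, and formulas of the form $P^{\mathrm{T}}\mathbin{\triangleleft\wedge}P^*$ are $\mathrm{T}*$-terms. -}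

module Defs where

open import Data.Product using (_×_)
open import Data.Sum using (_⊎_)
open import Relation.Nullary using (¬_)
open import Data.Unit using (⊤)
open import Data.Empty using (⊥)

module _ (A : Set) where

  data Form : Set where
    T    : Form
    atom : A → Form
    neg  : Form → Form
    _◁∧_ : Form → Form → Form

  -- Trees: X ::= T | F | X ⊴ a ⊵ X
  data Tree : Set where
    leafT : Tree
    leafF : Tree
    node  : Tree → A → Tree → Tree

module _ {A : Set} where

  F : Form A
  F = neg T

  _◁∨_ : Form A → Form A → Form A
  x ◁∨ y = neg (neg x ◁∧ neg y)

  subst : Tree A → Tree A → Tree A → Tree A
  subst leafT        Y Z = Y
  subst leafF        Y Z = Z
  subst (node L a R) Y Z = node (subst L Y Z) a (subst R Y Z)

  se : Form A → Tree A
  se T        = leafT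
  se (atom a) = node leafT a leafF
  se (neg x)  = subst (se x) leafF leafT
  se (x ◁∧ y) = subst (se x) (se y) leafF

  ClosedT : Tree A → Set
  ClosedT leafT        = ⊤
  ClosedT leafF        = ⊥
  ClosedT (node L a R) = ClosedT L × ClosedT R

  ClosedF : Tree A → Set
  ClosedF leafT        = ⊥
  ClosedF leafF        = ⊤
  ClosedF (node L a R) = ClosedF L × ClosedF R

  Closed : Tree A → Set
  Closed X = ClosedT X ⊎ ClosedF X

  Open : Tree A → Set
  Open X = ¬ Closed X

  data IsPT : Form A → Set where
    pT-T  : IsPT T
    pT-or : ∀ {a x y} → IsPT x → IsPT y → IsPT ((atom a ◁∧ x) ◁∨ y)

  data IsPF : Form A → Set where
    pF-F   : IsPF F
    pF-and : ∀ {a x y} → IsPF x → IsPF y → IsPF ((atom a ◁∨ x) ◁∧ y)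

  data IsPℓ : Form A → Set where
    pℓ-pos : ∀ {a x y} → IsPT x → IsPF y → IsPℓ ((atom a ◁∧ x) ◁∨ y)
    pℓ-neg : ∀ {a x y} → IsPT x → IsPF y → IsPℓ ((neg (atom a) ◁∧ x) ◁∨ y)

  data IsPstar : Form A → Set
  data IsPc    : Form A → Set
  data IsPd    : Form A → Set

  data IsPstar where
    pstar-c : ∀ {x} → IsPc x → IsPstar x
    pstar-d : ∀ {x} → IsPd x → IsPstar x

  data IsPc where
    pc-ℓ   : ∀ {x} → IsPℓ x → IsPc x
    pc-and : ∀ {x y} → IsPstar x → IsPd y → IsPc (x ◁∧ y)

  data IsPd where
    pd-ℓ  : ∀ {x} → IsPℓ x → IsPd x
    pd-or : ∀ {x y} → IsPstar x → IsPc y → IsPd (x ◁∨ y)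

  data IsTstar : Form A → Set where
    tstar : ∀ {x y} → IsPT x → IsPstar y → IsTstar (x ◁∧ y)

module Submission where

-- Everything rests on how substitution X[T ↦ Y, F ↦ Z] moves
-- information about leaves.
--   * Closure: X[T ↦ Y, F ↦ Z] is closed by F when Y and Z are, closed by T
--     when X is closed by F and Z by T, and closed by F when X is closed by T
--     and Y by F.  Hence ¬ exchanges closure by T and by F, and x ◁∧ y is closed
--     by F as soon as y is; this gives (a) and (b) by induction on the grammar.
--   * Occurrence: a subtree of Y (resp. Z) occurs in X[T ↦ Y, F ↦ Z] as soon
--     as X has a T-leaf (resp. an F-leaf).  Hence se(x ◁∧ y), se(¬x) and
--     se(x ◁∨ y) contain a T-leaf / an F-leaf under simple conditions on x, y.
-- Call a tree mixed if it has both a T-leaf and an F-leaf; a mixed tree is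
-- open.  Literals are mixed, ℓ-terms are mixed by the occurrence lemmas and
-- (a), (b); P^*-terms are mixed by mutual induction on P^*, P^c, P^d; and a
-- T*-term x ◁∧ y is mixed because se(x) has a T-leaf and se(y) is mixed.

open import Defs
open import Data.Product using (_×_; _,_; proj₁; proj₂)
open import Data.Sum using (_⊎_; inj₁; inj₂)
open import Data.Unit using (tt)

module _ {A : Set} where

  data _⊑_ (W : Tree A) : Tree A → Set where
    here : W ⊑ W
    left  : ∀ {L a R} → W ⊑ L → W ⊑ node L a R
    right : ∀ {L a R} → W ⊑ R → W ⊑ node L a R

  ClosedT-⊑ : ∀ {W X : Tree A} → W ⊑ X → ClosedT X → ClosedT W
  ClosedT-⊑ here      c       = c
  ClosedT-⊑ (left p)  (c , _) = ClosedT-⊑ p c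
  ClosedT-⊑ (right p) (_ , c) = ClosedT-⊑ p c

  ClosedF-⊑ : ∀ {W X : Tree A} → W ⊑ X → ClosedF X → ClosedF W
  ClosedF-⊑ here      c       = c
  ClosedF-⊑ (left p)  (c , _) = ClosedF-⊑ p c
  ClosedF-⊑ (right p) (_ , c) = ClosedF-⊑ p c

  ClosedT⇒leafT : ∀ (X : Tree A) → ClosedT X → leafT ⊑ X
  ClosedT⇒leafT leafT        _       = here
  ClosedT⇒leafT (node L a R) (c , _) = left (ClosedT⇒leafT L c)

  ClosedF⇒leafF : ∀ (X : Tree A) → ClosedF X → leafF ⊑ X
  ClosedF⇒leafF leafF        _       = here
  ClosedF⇒leafF (node L a R) (c , _) = left (ClosedF⇒leafF L c)

  Mixed : Tree A → Set
  Mixed X = leafT ⊑ X × leafF ⊑ X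

  Mixed⇒Open : ∀ {X : Tree A} → Mixed X → Open X
  Mixed⇒Open (_ , hasF) (inj₁ closedT) = ClosedT-⊑ hasF closedT
  Mixed⇒Open (hasT , _) (inj₂ closedF) = ClosedF-⊑ hasT closedF

  subst-ClosedF-both : ∀ (X : Tree A) {Y Z} → ClosedF Y → ClosedF Z → ClosedF (subst X Y Z)
  subst-ClosedF-both leafT        cy cz = cy
  subst-ClosedF-both leafF        cy cz = cz
  subst-ClosedF-both (node L a R) cy cz = subst-ClosedF-both L cy cz , subst-ClosedF-both R cy cz

  subst-ClosedT-viaF : ∀ (X : Tree A) {Y Z} → ClosedF X → ClosedT Z → ClosedT (subst X Y Z)
  subst-ClosedT-viaF leafF        _         cz = cz
  subst-ClosedT-viaF (node L a R) (cl , cr) cz = subst-ClosedT-viaF L cl cz , subst-ClosedT-viaF R cr cz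

  subst-ClosedF-viaT : ∀ (X : Tree A) {Y Z} → ClosedT X → ClosedF Y → ClosedF (subst X Y Z)
  subst-ClosedF-viaT leafT        _         cy = cy
  subst-ClosedF-viaT (node L a R) (cl , cr) cy = subst-ClosedF-viaT L cl cy , subst-ClosedF-viaT R cr cy

  subst-⊑T : ∀ {W X : Tree A} {Y} Z → leafT ⊑ X → W ⊑ Y → W ⊑ subst X Y Z
  subst-⊑T Z here      w = w
  subst-⊑T Z (left p)  w = left (subst-⊑T Z p w)
  subst-⊑T Z (right p) w = right (subst-⊑T Z p w)

  subst-⊑F : ∀ {W X : Tree A} Y {Z} → leafF ⊑ X → W ⊑ Z → W ⊑ subst X Y Z
  subst-⊑F Y here      w = w
  subst-⊑F Y (left p)  w = left (subst-⊑F Y p w)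
  subst-⊑F Y (right p) w = right (subst-⊑F Y p w)

  neg-ClosedT : ∀ (x : Form A) → ClosedF (se x) → ClosedT (se (neg x))
  neg-ClosedT x c = subst-ClosedT-viaF (se x) c tt

  neg-ClosedF : ∀ (x : Form A) → ClosedT (se x) → ClosedF (se (neg x))
  neg-ClosedF x c = subst-ClosedF-viaT (se x) c tt

  and-ClosedF : ∀ (x y : Form A) → ClosedF (se y) → ClosedF (se (x ◁∧ y))
  and-ClosedF x y c = subst-ClosedF-both (se x) c tt

  -- Part (a) and (b): T-terms are closed by T and F-terms are closed by F.
  -- Only the last disjunct (resp. conjunct) matters.
  T-term-ClosedT : ∀ {x : Form A} → IsPT x → ClosedT (se x)
  T-term-ClosedT pT-T = tt
  T-term-ClosedT (pT-or {a} {x} {y} _ py) =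
    neg-ClosedT (neg (atom a ◁∧ x) ◁∧ neg y)
      (and-ClosedF (neg (atom a ◁∧ x)) (neg y) (neg-ClosedF y (T-term-ClosedT py)))

  F-term-ClosedF : ∀ {x : Form A} → IsPF x → ClosedF (se x)
  F-term-ClosedF pF-F = tt
  F-term-ClosedF (pF-and {a} {x} {y} _ py) = and-ClosedF (atom a ◁∨ x) y (F-term-ClosedF py)

  -- Leaves of se for the connectives (formulas are explicit since se is not
  -- injective).  The ◁∨ facts are the ◁∧ facts transported through ¬.
  neg-leafT : ∀ (x : Form A) → leafF ⊑ se x → leafT ⊑ se (neg x)
  neg-leafT x p = subst-⊑F leafF p here

  neg-leafF : ∀ (x : Form A) → leafT ⊑ se x → leafF ⊑ se (neg x)
  neg-leafF x p = subst-⊑T leafT p here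

  and-leafT : ∀ (x y : Form A) → leafT ⊑ se x → leafT ⊑ se y → leafT ⊑ se (x ◁∧ y)
  and-leafT x y p q = subst-⊑T leafF p q

  and-leafF-left : ∀ (x y : Form A) → leafF ⊑ se x → leafF ⊑ se (x ◁∧ y)
  and-leafF-left x y p = subst-⊑F (se y) p here

  and-leafF-right : ∀ (x y : Form A) → leafT ⊑ se x → leafF ⊑ se y → leafF ⊑ se (x ◁∧ y)
  and-leafF-right x y p q = subst-⊑T leafF p q

  or-leafT-left : ∀ (x y : Form A) → leafT ⊑ se x → leafT ⊑ se (x ◁∨ y)
  or-leafT-left x y p =
    neg-leafT (neg x ◁∧ neg y) (and-leafF-left (neg x) (neg y) (neg-leafF x p))

  or-leafT-right : ∀ (x y : Form A) → leafF ⊑ se x → leafT ⊑ se y → leafT ⊑ se (x ◁∨ y)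
  or-leafT-right x y p q =
    neg-leafT (neg x ◁∧ neg y)
      (and-leafF-right (neg x) (neg y) (neg-leafT x p) (neg-leafF y q))

  or-leafF : ∀ (x y : Form A) → leafF ⊑ se x → leafF ⊑ se y → leafF ⊑ se (x ◁∨ y)
  or-leafF x y p q =
    neg-leafF (neg x ◁∧ neg y) (and-leafT (neg x) (neg y) (neg-leafT x p) (neg-leafT y q))

  and-Mixed : ∀ (x y : Form A) → leafT ⊑ se x → Mixed (se y) → Mixed (se (x ◁∧ y))
  and-Mixed x y p (t , f) = and-leafT x y p t , and-leafF-right x y p f

  or-Mixed : ∀ (x y : Form A) → leafF ⊑ se x → Mixed (se y) → Mixed (se (x ◁∨ y))
  or-Mixed x y p (t , f) = or-leafT-right x y p t , or-leafF x y p f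

  -- A formula (u ◁∧ x) ◁∨ y with u mixed, x a T-term and y an F-term is mixed:
  -- its T-leaf comes from u and x, its F-leaf from u and y.
  ℓ-shape-Mixed : ∀ (u x y : Form A) → Mixed (se u) → IsPT x → IsPF y →
                  Mixed (se ((u ◁∧ x) ◁∨ y))
  ℓ-shape-Mixed u x y (t , f) px py =
    or-leafT-left (u ◁∧ x) y
      (and-leafT u x t (ClosedT⇒leafT (se x) (T-term-ClosedT px))) ,
    or-leafF (u ◁∧ x) y
      (and-leafF-left u x f) (ClosedF⇒leafF (se y) (F-term-ClosedF py))

  -- ℓ-terms are mixed, since the literals a and ¬a are.
  ℓ-term-Mixed : ∀ {x : Form A} → IsPℓ x → Mixed (se x)
  ℓ-term-Mixed (pℓ-pos {a} {x} {y} px py) =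
    ℓ-shape-Mixed (atom a) x y (left here , right here) px py
  ℓ-term-Mixed (pℓ-neg {a} {x} {y} px py) =
    ℓ-shape-Mixed (neg (atom a)) x y (right here , left here) px py

  P*-term-Mixed : ∀ {x : Form A} → IsPstar x → Mixed (se x)
  Pc-term-Mixed : ∀ {x : Form A} → IsPc x → Mixed (se x)
  Pd-term-Mixed : ∀ {x : Form A} → IsPd x → Mixed (se x)

  P*-term-Mixed (pstar-c p) = Pc-term-Mixed p
  P*-term-Mixed (pstar-d p) = Pd-term-Mixed p

  Pc-term-Mixed (pc-ℓ p) = ℓ-term-Mixed p
  Pc-term-Mixed (pc-and {x} {y} px py) =
    and-Mixed x y (proj₁ (P*-term-Mixed px)) (Pd-term-Mixed py)

  Pd-term-Mixed (pd-ℓ p) = ℓ-term-Mixed p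
  Pd-term-Mixed (pd-or {x} {y} px py) =
    or-Mixed x y (proj₂ (P*-term-Mixed px)) (Pc-term-Mixed py)

  -- T*-terms x ◁∧ y are mixed: se x is closed by T, so it has a T-leaf.
  T*-term-Mixed : ∀ {x : Form A} → IsTstar x → Mixed (se x)
  T*-term-Mixed (tstar {x} {y} px py) =
    and-Mixed x y (ClosedT⇒leafT (se x) (T-term-ClosedT px)) (P*-term-Mixed py)

proposition2p15 : {A : Set} → (x : Form A) →
    (IsPT x → ClosedT (se x)) ×
    (IsPF x → ClosedF (se x)) ×
    (IsPℓ x ⊎ IsTstar x → Open (se x))
proposition2p15 x = T-term-ClosedT , F-term-ClosedF , ℓ-or-T*-term-Open
  where
    ℓ-or-T*-term-Open : IsPℓ x ⊎ IsTstar x → Open (se x)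
    ℓ-or-T*-term-Open (inj₁ p) = Mixed⇒Open (ℓ-term-Mixed p)
    ℓ-or-T*-term-Open (inj₂ p) = Mixed⇒Open (T*-term-Mixed p)
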